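{- The following seven graphs on vertex set $\{1,\dots,8\}$ are forbidden: $F(8,12,1)$: edges $\{4,6\},\{1,4\},\{1,2\},\{2,3\},\{3,6\},\{5,6\},\{2,5\},\{1,3\},\{4,7\},\{6,7\},\{6,8\},\{4,8\}$; $F(8,12,2)$: edges $\{4,6\},\{1,4\},\{1,2\},\{2,3\},\{3,6\},\{5,6\},\{2,5\},\{1,3\},\{6,8\},\{4,8\},\{7,8\},\{5,7\}$; $F(8,13,3)$: edges $\{1,5\},\{1,3\},\{1,2\},\{2,3\},\{3,5\},\{5,6\},\{6,7\},\{3,7\},\{3,6\},\{2,4\},\{3,4\},\{3,8\},\{4,8\}$; $F(8,13,4)$: edges $\{1,5\},\{1,3\},\{1,2\},\{2,3\},\{3,5\},\{5,6\},\{6,7\},\{3,7\},\{3,6\},\{2,4\},\{3,4\},\{2,8\},\{7,8\}$; $F(8,13,5)$: edges $\{1,8\},\{4,8\},\{1,5\},\{1,3\},\{1,2\},\{2,3\},\{3,5\},\{5,6\},\{6,7\},\{3,7\},\{3,6\},\{4,7\},\{2,4\}$; $F(8,13,6)$: edges $\{5,8\},\{4,8\},\{1,5\},\{1,3\},\{1,2\},\{2,3\},\{3,5\},\{5,6\},\{6,7\},\{3,7\},\{3,6\},\{4,7\},\{2,4\}$; $F(8,13,7)$: edges $\{1,3\},\{1,2\},\{2,4\},\{3,4\},\{2,3\},\{5,7\},\{5,6\},\{6,8\},\{7,8\},\{1,5\},\{3,7\},\{4,8\},\{1,6\}$.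
   Context: All graphs are finite and simple. A graph $G$ with vertex set $V$ is unit-distance if there exists an injective map $\varphi\colon V\to\mathbf{R}^2$ with $|\varphi(v)-\varphi(w)|=1$ for every pair of adjacent vertices $v,w$ (non-adjacent vertices may also be at distance 1). A graph is forbidden if it is not unit-distance. -}

module Defs where

open import Level using (0ℓ)
open import Algebra.Bundles using (CommutativeRing)
open import Data.Nat using (ℕ; suc)
open import Data.Fin using (Fin; toℕ)
open import Data.Product using (_×_; _,_; ∃; Σ)
open import Data.Sum using (_⊎_)
open import Data.List using (List)
open import Data.List.Membership.Propositional using (_∈_)
open import Relation.Nullary using (¬_)
open import Relation.Binary.PropositionalEquality using (_≡_)

-- A model of the real numbers: a complete ordered field
-- (commutative ring + multiplicative inverses + strict total order compatible
-- with the operations + least-upper-bound property).  Any two such models are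
-- isomorphic, so quantifying over all of them is the same as speaking of ℝ.
record Reals : Set₁ where
  field
    ℝring : CommutativeRing 0ℓ 0ℓ
  open CommutativeRing ℝring public
  field
    _<_         : Carrier → Carrier → Set
    <-resp-≈    : ∀ {x x' y y'} → x ≈ x' → y ≈ y' → x < y → x' < y'
    <-irrefl    : ∀ x → ¬ (x < x)
    <-trans     : ∀ {x y z} → x < y → y < z → x < z
    <-trichot   : ∀ x y → x < y ⊎ (x ≈ y ⊎ y < x)
    +-mono-<    : ∀ {x y} z → x < y → (x + z) < (y + z)
    *-pos       : ∀ {x y} → 0# < x → 0# < y → 0# < (x * y)
    0<1         : 0# < 1#
    inverse     : ∀ x → ¬ (x ≈ 0#) → ∃ λ y → (x * y) ≈ 1#
  _≤_ : Carrier → Carrier → Set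
  x ≤ y = x < y ⊎ x ≈ y
  UpperBound : (Carrier → Set) → Carrier → Set
  UpperBound S b = ∀ s → S s → s ≤ b
  IsSup : (Carrier → Set) → Carrier → Set
  IsSup S u = UpperBound S u × (∀ b → UpperBound S b → u ≤ b)
  field
    complete : ∀ (S : Carrier → Set) → ∃ S → ∃ (UpperBound S) → ∃ (IsSup S)

-- A finite simple graph on vertex set {1,…,n}, given by its list of edges
-- {i,j} written as pairs of natural numbers in 1..n.  Vertex v : Fin n stands
-- for the number toℕ v + 1.
EdgeList : Set
EdgeList = List (ℕ × ℕ)

Adj : {n : ℕ} → EdgeList → Fin n → Fin n → Set
Adj E v w = (suc (toℕ v) , suc (toℕ w)) ∈ E ⊎ (suc (toℕ w) , suc (toℕ v)) ∈ E

module _ (R : Reals) where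
  open Reals R

  Point : Set
  Point = Carrier × Carrier

  _≈ᵖ_ : Point → Point → Set
  (a , b) ≈ᵖ (c , d) = (a ≈ c) × (b ≈ d)

  -- squared Euclidean distance; |p - q| = 1 iff |p - q|² = 1 (distances ≥ 0)
  dist² : Point → Point → Carrier
  dist² (a , b) (c , d) = ((a - c) * (a - c)) + ((b - d) * (b - d))

  UnitDistanceIn : (n : ℕ) → EdgeList → Set
  UnitDistanceIn n E =
    Σ (Fin n → Point) λ φ →
      (∀ v w → φ v ≈ᵖ φ w → v ≡ w) ×
      (∀ v w → Adj E v w → dist² (φ v) (φ w) ≈ 1#)

Forbidden : (n : ℕ) → EdgeList → Set₁
Forbidden n E = (R : Reals) → ¬ UnitDistanceIn R n E

-- The only geometry needed is the rhombus lemma (Plane.rhombus-or-equal):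
-- if x and y both lie at distance 1 from two distinct points a and c, then
-- x = y or x + y = a + c, since two unit circles meet in at most two points,
-- symmetric about the midpoint of their centres.
--
-- For a drawing p of a graph every application of the lemma yields an
-- integer linear relation among the points p 1, …, p 8.  Such relations are
-- represented by their coefficient vectors (LinearForms, Drawing), so that
-- adding and subtracting relations is integer arithmetic that Agda checks by
-- computation.  For each graph a few rhombi produce relations summing to
-- p i - p j = 0 for distinct vertices i ≠ j, contradicting injectivity of
-- the drawing (ForbiddenGraphs).
module Submission where

open import Defs
open import Level using (0ℓ)
open import Algebra.Bundles using (CommutativeRing)
open import Algebra.Construct.DirectProduct using (commutativeRing)
open import Data.Nat as ℕ using (ℕ; zero; suc; z≤n; s≤s)
import Data.Nat.Properties as ℕₚ
open import Data.Integer as ℤ using (ℤ; +_; -[1+_]; _◃_; sign; ∣_∣)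
import Data.Integer.Properties as ℤₚ
open import Data.Sign as Sign using (Sign)
open import Data.Fin as Fin using (Fin; zero; suc; fromℕ<)
open import Data.Vec using (Vec; []; _∷_; zipWith; replicate)
open import Data.Product using (_×_; _,_; proj₁; proj₂)
open import Data.Product.Properties using (≡-dec)
open import Data.Sum using (_⊎_; inj₁; inj₂; [_,_]′)
open import Data.Empty using (⊥; ⊥-elim)
open import Data.List using (_∷_; [])
open import Data.List.Membership.DecPropositional (≡-dec ℕ._≟_ ℕ._≟_) using (_∈?_)
open import Data.Maybe using (Maybe; just; nothing)
open import Relation.Nullary using (¬_; Dec; yes; no)
open import Relation.Nullary.Decidable using (True; False; toWitness; toWitnessFalse; _⊎-dec_; _×-dec_)
import Relation.Binary.PropositionalEquality as ≡

-- Every commutative ring receives the canonical ring morphism from ℤ;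
-- it lets the standard ring solver normalise with integer coefficients.
module IntegerCoefficients (R : CommutativeRing 0ℓ 0ℓ) where
  open CommutativeRing R hiding (zero)
  open import Algebra.Properties.Semiring.Mult semiring using (×-homo-+; ×1-homo-*)
    renaming (_×_ to _times_)
  open import Algebra.Properties.Ring ring using (-‿distribˡ-*; -‿distribʳ-*; -‿involutive; -0#≈0#)
  open import Algebra.Properties.AbelianGroup +-abelianGroup using (⁻¹-∙-comm)
  open import Algebra.Solver.Ring.AlmostCommutativeRing
    using (_-Raw-AlmostCommutative⟶_; fromCommutativeRing)
  open import Relation.Binary.Reasoning.Setoid setoid

  ⟦_⟧ℤ : ℤ → Carrier
  ⟦ + n ⟧ℤ = n times 1#
  ⟦ -[1+ n ] ⟧ℤ = - (suc n times 1#)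

  ⊖-homo : ∀ m n → ⟦ m ℤ.⊖ n ⟧ℤ ≈ m times 1# - n times 1#
  ⊖-homo m zero = begin
    ⟦ m ℤ.⊖ zero ⟧ℤ        ≡⟨ ≡.cong ⟦_⟧ℤ (ℤₚ.⊖-≥ {m} z≤n) ⟩
    m times 1#             ≈⟨ sym (+-identityʳ _) ⟩
    m times 1# + 0#        ≈⟨ +-congˡ (sym -0#≈0#) ⟩
    m times 1# - 0#        ∎
  ⊖-homo zero (suc n) = begin
    ⟦ zero ℤ.⊖ suc n ⟧ℤ    ≡⟨ ≡.cong ⟦_⟧ℤ (ℤₚ.⊖-< {zero} {suc n} (s≤s z≤n)) ⟩
    - (suc n times 1#)     ≈⟨ sym (+-identityˡ _) ⟩
    0# - suc n times 1#    ∎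
  ⊖-homo (suc m) (suc n) = begin
    ⟦ suc m ℤ.⊖ suc n ⟧ℤ                    ≡⟨ ≡.cong ⟦_⟧ℤ (ℤₚ.[1+m]⊖[1+n]≡m⊖n m n) ⟩
    ⟦ m ℤ.⊖ n ⟧ℤ                            ≈⟨ ⊖-homo m n ⟩
    m times 1# - n times 1#                 ≈⟨ sym (cancel-1# (m times 1#) (n times 1#)) ⟩
    (1# + m times 1#) - (1# + n times 1#)   ∎
    where
    cancel-1# : ∀ a b → (1# + a) - (1# + b) ≈ a - b
    cancel-1# a b = begin
      (1# + a) + - (1# + b)     ≈⟨ +-cong (+-comm 1# a) (sym (⁻¹-∙-comm 1# b)) ⟩
      (a + 1#) + (- 1# + - b)   ≈⟨ +-assoc a 1# _ ⟩
      a + (1# + (- 1# + - b))   ≈⟨ +-congˡ (sym (+-assoc 1# (- 1#) (- b))) ⟩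
      a + ((1# - 1#) + - b)     ≈⟨ +-congˡ (+-congʳ (-‿inverseʳ 1#)) ⟩
      a + (0# + - b)            ≈⟨ +-congˡ (+-identityˡ (- b)) ⟩
      a - b                     ∎

  +-homo : ∀ i j → ⟦ i ℤ.+ j ⟧ℤ ≈ ⟦ i ⟧ℤ + ⟦ j ⟧ℤ
  +-homo (+ m) (+ n) = ×-homo-+ 1# m n
  +-homo (+ m) -[1+ n ] = ⊖-homo m (suc n)
  +-homo -[1+ m ] (+ n) = trans (⊖-homo n (suc m)) (+-comm _ _)
  +-homo -[1+ m ] -[1+ n ] = begin
    - (suc (suc (m ℕ.+ n)) times 1#)          ≡⟨ ≡.cong (λ k → - (suc k times 1#)) (≡.sym (ℕₚ.+-suc m n)) ⟩
    - ((suc m ℕ.+ suc n) times 1#)            ≈⟨ -‿cong (×-homo-+ 1# (suc m) (suc n)) ⟩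
    - (suc m times 1# + suc n times 1#)       ≈⟨ sym (⁻¹-∙-comm _ _) ⟩
    - (suc m times 1#) + - (suc n times 1#)   ∎

  neg-homo : ∀ i → ⟦ ℤ.- i ⟧ℤ ≈ - ⟦ i ⟧ℤ
  neg-homo (+ zero) = sym -0#≈0#
  neg-homo (+ suc n) = refl
  neg-homo -[1+ n ] = sym (-‿involutive _)

  -- Multiplication: ℤ multiplies signs and absolute values separately, so
  -- ⟦_⟧ℤ is split into the action σ of a sign on ∣ i ∣ times 1#.
  σ : Sign → Carrier → Carrier
  σ Sign.+ x = x
  σ Sign.- x = - x

  σ-cong : ∀ s {x y} → x ≈ y → σ s x ≈ σ s y
  σ-cong Sign.+ x≈y = x≈y
  σ-cong Sign.- x≈y = -‿cong x≈y

  σ-* : ∀ s t a b → σ (s Sign.* t) (a * b) ≈ σ s a * σ t b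
  σ-* Sign.+ Sign.+ a b = refl
  σ-* Sign.+ Sign.- a b = -‿distribʳ-* a b
  σ-* Sign.- Sign.+ a b = -‿distribˡ-* a b
  σ-* Sign.- Sign.- a b = begin
    a * b          ≈⟨ sym (-‿involutive _) ⟩
    - - (a * b)    ≈⟨ -‿cong (-‿distribʳ-* a b) ⟩
    - (a * - b)    ≈⟨ -‿distribˡ-* a (- b) ⟩
    - a * - b      ∎

  ◃-homo : ∀ s n → ⟦ s ◃ n ⟧ℤ ≈ σ s (n times 1#)
  ◃-homo Sign.+ zero = refl
  ◃-homo Sign.- zero = sym -0#≈0#
  ◃-homo Sign.+ (suc n) = refl
  ◃-homo Sign.- (suc n) = refl

  sign-abs : ∀ i → σ (sign i) (∣ i ∣ times 1#) ≈ ⟦ i ⟧ℤ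
  sign-abs (+ n) = refl
  sign-abs -[1+ n ] = refl

  *-homo : ∀ i j → ⟦ i ℤ.* j ⟧ℤ ≈ ⟦ i ⟧ℤ * ⟦ j ⟧ℤ
  *-homo i j = begin
    ⟦ s ◃ (∣ i ∣ ℕ.* ∣ j ∣) ⟧ℤ                                ≈⟨ ◃-homo s (∣ i ∣ ℕ.* ∣ j ∣) ⟩
    σ s ((∣ i ∣ ℕ.* ∣ j ∣) times 1#)                          ≈⟨ σ-cong s (×1-homo-* ∣ i ∣ ∣ j ∣) ⟩
    σ s (∣ i ∣ times 1# * ∣ j ∣ times 1#)                     ≈⟨ σ-* (sign i) (sign j) _ _ ⟩
    σ (sign i) (∣ i ∣ times 1#) * σ (sign j) (∣ j ∣ times 1#) ≈⟨ *-cong (sign-abs i) (sign-abs j) ⟩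
    ⟦ i ⟧ℤ * ⟦ j ⟧ℤ                                           ∎
    where
    s : Sign
    s = sign i Sign.* sign j

  ℤ-morphism : CommutativeRing.rawRing ℤₚ.+-*-commutativeRing -Raw-AlmostCommutative⟶ fromCommutativeRing R
  ℤ-morphism = record
    { ⟦_⟧ = ⟦_⟧ℤ ; +-homo = +-homo ; *-homo = *-homo ; -‿homo = neg-homo
    ; 0-homo = refl ; 1-homo = +-identityʳ 1# }

  coefficient-equality : ∀ i j → Maybe (⟦ i ⟧ℤ ≈ ⟦ j ⟧ℤ)
  coefficient-equality i j with i ℤ.≟ j
  ... | yes ≡.refl = just refl
  ... | no _ = nothing

  open import Algebra.Solver.Ring (CommutativeRing.rawRing ℤₚ.+-*-commutativeRing)
    (fromCommutativeRing R) ℤ-morphism coefficient-equality public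

module OrderedField (R : Reals) where
  open Reals R
  open IntegerCoefficients ℝring using (⟦_⟧ℤ; solve; _:=_; _:+_; _:-_; _:*_; :-_)
  open import Relation.Binary.Reasoning.Setoid setoid

  ≈-decidable : ∀ x y → x ≈ y ⊎ ¬ x ≈ y
  ≈-decidable x y with <-trichot x y
  ... | inj₁ x<y = inj₂ (λ x≈y → <-irrefl y (<-resp-≈ x≈y refl x<y))
  ... | inj₂ (inj₁ x≈y) = inj₁ x≈y
  ... | inj₂ (inj₂ y<x) = inj₂ (λ x≈y → <-irrefl y (<-resp-≈ refl x≈y y<x))

  no-zero-divisors : ∀ x y → x * y ≈ 0# → x ≈ 0# ⊎ y ≈ 0#
  no-zero-divisors x y xy≈0 with ≈-decidable x 0#
  ... | inj₁ x≈0 = inj₁ x≈0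
  ... | inj₂ x≉0 with inverse x x≉0
  ... | x⁻¹ , xx⁻¹≈1 = inj₂ (begin
    y                ≈⟨ sym (*-identityʳ y) ⟩
    y * 1#           ≈⟨ *-congˡ (sym xx⁻¹≈1) ⟩
    y * (x * x⁻¹)    ≈⟨ solve 3 (λ x y x⁻¹ → y :* (x :* x⁻¹) := (x :* y) :* x⁻¹) refl x y x⁻¹ ⟩
    (x * y) * x⁻¹    ≈⟨ *-congʳ xy≈0 ⟩
    0# * x⁻¹         ≈⟨ zeroˡ x⁻¹ ⟩
    0#               ∎)

  positive-sum : ∀ {a b} → 0# < a → 0# < b → 0# < (a + b)
  positive-sum {a} {b} 0<a 0<b =
    <-trans (<-resp-≈ refl (sym (+-identityˡ b)) 0<b) (+-mono-< b 0<a)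

  cancel-nonzero : ∀ {a b} → ¬ b ≈ 0# → a * b ≈ 0# → a ≈ 0#
  cancel-nonzero {a} {b} b≉0 ab≈0 with no-zero-divisors a b ab≈0
  ... | inj₁ a≈0 = a≈0
  ... | inj₂ b≈0 = ⊥-elim (b≉0 b≈0)

  2# : Carrier
  2# = ⟦ + 2 ⟧ℤ

  2≉0 : ¬ 2# ≈ 0#
  2≉0 2≈0 = <-irrefl 0# (<-resp-≈ refl 2≈0 0<2)
    where
    0<2 : 0# < (1# + (1# + 0#))
    0<2 = positive-sum 0<1 (<-resp-≈ refl (sym (+-identityʳ 1#)) 0<1)

  halve : ∀ {q} → 2# * q ≈ 0# → q ≈ 0#
  halve {q} 2q≈0 = cancel-nonzero 2≉0 (trans (*-comm q 2#) 2q≈0)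

  -- non-zero squares are positive: x² = (- x)² and one of x, - x is positive
  square-positive : ∀ x → ¬ x ≈ 0# → 0# < (x * x)
  square-positive x x≉0 with <-trichot x 0#
  ... | inj₁ x<0 = <-resp-≈ refl (solve 1 (λ x → (:- x) :* (:- x) := x :* x) refl x) (*-pos 0<-x 0<-x)
    where
    0<-x : 0# < (- x)
    0<-x = <-resp-≈ (-‿inverseʳ x) (+-identityˡ (- x)) (+-mono-< (- x) x<0)
  ... | inj₂ (inj₁ x≈0) = ⊥-elim (x≉0 x≈0)
  ... | inj₂ (inj₂ 0<x) = *-pos 0<x 0<x

  square-nonnegative : ∀ x → 0# ≤ (x * x)
  square-nonnegative x with ≈-decidable x 0#
  ... | inj₁ x≈0 = inj₂ (sym (trans (*-congʳ x≈0) (zeroˡ x)))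
  ... | inj₂ x≉0 = inj₁ (square-positive x x≉0)

  -- if x ≠ 0 then x² + y² > 0
  sum-of-squares-zero : ∀ x y → x * x + y * y ≈ 0# → x ≈ 0#
  sum-of-squares-zero x y sum≈0 with ≈-decidable x 0#
  ... | inj₁ x≈0 = x≈0
  ... | inj₂ x≉0 = ⊥-elim (<-irrefl 0# (<-resp-≈ refl sum≈0 0<sum))
    where
    0<sum : 0# < (x * x + y * y)
    0<sum with square-nonnegative y
    ... | inj₁ 0<yy = positive-sum (square-positive x x≉0) 0<yy
    ... | inj₂ 0≈yy = <-resp-≈ refl (trans (sym (+-identityʳ _)) (+-congˡ 0≈yy)) (square-positive x x≉0)

-- Euclidean plane geometry over a model of ℝ.  Points form the ring ℝ × ℝ
-- (coordinatewise operations), of which only the additive group is used.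
module Plane (R : Reals) where
  open Reals R
  open OrderedField R
  open IntegerCoefficients ℝring using (solve; _:=_; _:+_; _:-_; _:*_; con)
  open import Algebra.Properties.Group +-group using (x∙y⁻¹≈ε⇒x≈y; x≈y⇒x∙y⁻¹≈ε)
  open import Relation.Binary.Reasoning.Setoid setoid

  ℝ² : CommutativeRing 0ℓ 0ℓ
  ℝ² = commutativeRing ℝring ℝring

  open CommutativeRing ℝ² public
    using () renaming (_≈_ to _≋_; _+_ to _⊕_; _-_ to _⊖_; 0# to 𝟎)
  open import Algebra.Properties.Group (CommutativeRing.+-group ℝ²)
    using () renaming (x∙y⁻¹≈ε⇒x≈y to ≋-by-difference; x≈y⇒x∙y⁻¹≈ε to ≋-difference) public
  module V = IntegerCoefficients ℝ²
  module ≋ = CommutativeRing ℝ²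

  sum-zero : ∀ {a b} → a ≈ 0# → b ≈ 0# → a + b ≈ 0#
  sum-zero a≈0 b≈0 = trans (+-cong a≈0 b≈0) (+-identityʳ 0#)

  difference-zero : ∀ {a b} → a ≈ 0# → b ≈ 0# → a - b ≈ 0#
  difference-zero a≈0 b≈0 = x≈y⇒x∙y⁻¹≈ε (trans a≈0 (sym b≈0))

  infix 7 _·_ _∧_
  _·_ _∧_ : Point R → Point R → Carrier
  (x₁ , x₂) · (y₁ , y₂) = x₁ * y₁ + x₂ * y₂
  (x₁ , x₂) ∧ (y₁ , y₂) = x₁ * y₂ - x₂ * y₁

  ∥_∥² : Point R → Carrier
  ∥ x ∥² = x · x

  ∥∥²-cong : ∀ {x y} → x ≋ y → ∥ x ∥² ≈ ∥ y ∥²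
  ∥∥²-cong (x₁≈y₁ , x₂≈y₂) = +-cong (*-cong x₁≈y₁ x₁≈y₁) (*-cong x₂≈y₂ x₂≈y₂)

  ∥∥²-zero : ∀ x → ∥ x ∥² ≈ 0# → x ≋ 𝟎
  ∥∥²-zero (x₁ , x₂) ∥x∥²≈0 =
    sum-of-squares-zero x₁ x₂ ∥x∥²≈0 , sum-of-squares-zero x₂ x₁ (trans (+-comm _ _) ∥x∥²≈0)

  -- polarisation: a point at distance 1 from both 𝟎 and d projects onto
  -- the midpoint of 𝟎 and d
  equidistant-projection : ∀ x d → ∥ x ∥² ≈ 1# → ∥ x ⊖ d ∥² ≈ 1# → 2# * (x · d) ≈ ∥ d ∥²
  equidistant-projection x@(x₁ , x₂) d@(d₁ , d₂) ∥x∥²≈1 ∥x-d∥²≈1 = x∙y⁻¹≈ε⇒x≈y _ _ (begin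
    2# * (x · d) - ∥ d ∥²      ≈⟨ solve 4 (λ x₁ x₂ d₁ d₂ →
                                     con (+ 2) :* (x₁ :* d₁ :+ x₂ :* d₂) :- (d₁ :* d₁ :+ d₂ :* d₂)
                                     := (x₁ :* x₁ :+ x₂ :* x₂)
                                        :- ((x₁ :- d₁) :* (x₁ :- d₁) :+ (x₂ :- d₂) :* (x₂ :- d₂)))
                                   refl x₁ x₂ d₁ d₂ ⟩
    ∥ x ∥² - ∥ x ⊖ d ∥²         ≈⟨ x≈y⇒x∙y⁻¹≈ε (trans ∥x∥²≈1 (sym ∥x-d∥²≈1)) ⟩
    0#                         ∎)

  common-normal : ∀ e s d → ¬ e ≋ 𝟎 → e · s ≈ 0# → e · d ≈ 0# → s ∧ d ≈ 0#
  common-normal e@(e₁ , e₂) s@(s₁ , s₂) d@(d₁ , d₂) e≉0 e·s≈0 e·d≈0 =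
    unless-e-vanishes (no-zero-divisors e₁ (s ∧ d) first) (no-zero-divisors e₂ (s ∧ d) second)
    where
    unless-e-vanishes : e₁ ≈ 0# ⊎ s ∧ d ≈ 0# → e₂ ≈ 0# ⊎ s ∧ d ≈ 0# → s ∧ d ≈ 0#
    unless-e-vanishes (inj₂ s∧d≈0) _ = s∧d≈0
    unless-e-vanishes (inj₁ _) (inj₂ s∧d≈0) = s∧d≈0
    unless-e-vanishes (inj₁ e₁≈0) (inj₁ e₂≈0) = ⊥-elim (e≉0 (e₁≈0 , e₂≈0))
    first : e₁ * (s ∧ d) ≈ 0#
    first = begin
      e₁ * (s ∧ d)                    ≈⟨ solve 6 (λ e₁ e₂ s₁ s₂ d₁ d₂ →
                                           e₁ :* (s₁ :* d₂ :- s₂ :* d₁)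
                                           := d₂ :* (e₁ :* s₁ :+ e₂ :* s₂) :- s₂ :* (e₁ :* d₁ :+ e₂ :* d₂))
                                         refl e₁ e₂ s₁ s₂ d₁ d₂ ⟩
      d₂ * (e · s) - s₂ * (e · d)     ≈⟨ +-cong (*-congˡ e·s≈0) (-‿cong (*-congˡ e·d≈0)) ⟩
      d₂ * 0# - s₂ * 0#               ≈⟨ difference-zero (zeroʳ d₂) (zeroʳ s₂) ⟩
      0#                              ∎
    second : e₂ * (s ∧ d) ≈ 0#
    second = begin
      e₂ * (s ∧ d)                    ≈⟨ solve 6 (λ e₁ e₂ s₁ s₂ d₁ d₂ →
                                           e₂ :* (s₁ :* d₂ :- s₂ :* d₁)
                                           := s₁ :* (e₁ :* d₁ :+ e₂ :* d₂) :- d₁ :* (e₁ :* s₁ :+ e₂ :* s₂))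
                                         refl e₁ e₂ s₁ s₂ d₁ d₂ ⟩
      s₁ * (e · d) - d₁ * (e · s)     ≈⟨ +-cong (*-congˡ e·d≈0) (-‿cong (*-congˡ e·s≈0)) ⟩
      s₁ * 0# - d₁ * 0#               ≈⟨ difference-zero (zeroʳ s₁) (zeroʳ d₁) ⟩
      0#                              ∎

  lagrange : ∀ s d → ∥ s ∥² * ∥ d ∥² ≈ (s · d) * (s · d) + (s ∧ d) * (s ∧ d)
  lagrange (s₁ , s₂) (d₁ , d₂) = solve 4 (λ s₁ s₂ d₁ d₂ →
      (s₁ :* s₁ :+ s₂ :* s₂) :* (d₁ :* d₁ :+ d₂ :* d₂)
      := (s₁ :* d₁ :+ s₂ :* d₂) :* (s₁ :* d₁ :+ s₂ :* d₂) :+ (s₁ :* d₂ :- s₂ :* d₁) :* (s₁ :* d₂ :- s₂ :* d₁))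
    refl s₁ s₂ d₁ d₂

  projection-difference : ∀ x y d →
    2# * ((x ⊖ y) · d) ≈ (2# * (x · d) - ∥ d ∥²) - (2# * (y · d) - ∥ d ∥²)
  projection-difference (x₁ , x₂) (y₁ , y₂) (d₁ , d₂) = solve 6 (λ x₁ x₂ y₁ y₂ d₁ d₂ →
      con (+ 2) :* ((x₁ :- y₁) :* d₁ :+ (x₂ :- y₂) :* d₂)
      := (con (+ 2) :* (x₁ :* d₁ :+ x₂ :* d₂) :- (d₁ :* d₁ :+ d₂ :* d₂))
         :- (con (+ 2) :* (y₁ :* d₁ :+ y₂ :* d₂) :- (d₁ :* d₁ :+ d₂ :* d₂)))
    refl x₁ x₂ y₁ y₂ d₁ d₂

  projection-sum : ∀ x y d →
    2# * (((x ⊕ y) ⊖ d) · d) ≈ (2# * (x · d) - ∥ d ∥²) + (2# * (y · d) - ∥ d ∥²)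
  projection-sum (x₁ , x₂) (y₁ , y₂) (d₁ , d₂) = solve 6 (λ x₁ x₂ y₁ y₂ d₁ d₂ →
      con (+ 2) :* ((x₁ :+ y₁ :- d₁) :* d₁ :+ (x₂ :+ y₂ :- d₂) :* d₂)
      := (con (+ 2) :* (x₁ :* d₁ :+ x₂ :* d₂) :- (d₁ :* d₁ :+ d₂ :* d₂))
         :+ (con (+ 2) :* (y₁ :* d₁ :+ y₂ :* d₂) :- (d₁ :* d₁ :+ d₂ :* d₂)))
    refl x₁ x₂ y₁ y₂ d₁ d₂

  difference-dot-sum : ∀ x y d →
    (x ⊖ y) · ((x ⊕ y) ⊖ d) ≈ (∥ x ∥² - ∥ y ∥²) - (x ⊖ y) · d
  difference-dot-sum (x₁ , x₂) (y₁ , y₂) (d₁ , d₂) = solve 6 (λ x₁ x₂ y₁ y₂ d₁ d₂ →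
      (x₁ :- y₁) :* (x₁ :+ y₁ :- d₁) :+ (x₂ :- y₂) :* (x₂ :+ y₂ :- d₂)
      := ((x₁ :* x₁ :+ x₂ :* x₂) :- (y₁ :* y₁ :+ y₂ :* y₂)) :- ((x₁ :- y₁) :* d₁ :+ (x₂ :- y₂) :* d₂))
    refl x₁ x₂ y₁ y₂ d₁ d₂

  -- Indeed
  -- e = x - y and s = x + y - d are both orthogonal to d, e ⊥ s, and e ≠ 0,
  -- so s ∥ d while s ⊥ d, forcing s = 0.
  two-circles : ∀ x y d → ∥ x ∥² ≈ 1# → ∥ x ⊖ d ∥² ≈ 1# → ∥ y ∥² ≈ 1# → ∥ y ⊖ d ∥² ≈ 1# →
                ¬ x ≋ y → ¬ d ≋ 𝟎 → x ⊕ y ≋ d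
  two-circles x y d ∥x∥²≈1 ∥x-d∥²≈1 ∥y∥²≈1 ∥y-d∥²≈1 x≉y d≉0 =
    ≋-by-difference _ _ (∥∥²-zero s ∥s∥²≈0)
    where
    e s : Point R
    e = x ⊖ y
    s = (x ⊕ y) ⊖ d
    x-excess : 2# * (x · d) - ∥ d ∥² ≈ 0#
    x-excess = x≈y⇒x∙y⁻¹≈ε (equidistant-projection x d ∥x∥²≈1 ∥x-d∥²≈1)
    y-excess : 2# * (y · d) - ∥ d ∥² ≈ 0#
    y-excess = x≈y⇒x∙y⁻¹≈ε (equidistant-projection y d ∥y∥²≈1 ∥y-d∥²≈1)
    e⊥d : e · d ≈ 0#
    e⊥d = halve (trans (projection-difference x y d) (difference-zero x-excess y-excess))
    s⊥d : s · d ≈ 0#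
    s⊥d = halve (trans (projection-sum x y d) (sum-zero x-excess y-excess))
    e⊥s : e · s ≈ 0#
    e⊥s = trans (difference-dot-sum x y d)
                (difference-zero (x≈y⇒x∙y⁻¹≈ε (trans ∥x∥²≈1 (sym ∥y∥²≈1))) e⊥d)
    s∥d : s ∧ d ≈ 0#
    s∥d = common-normal e s d (λ e≋0 → x≉y (≋-by-difference x y e≋0)) e⊥s e⊥d
    ∥s∥²∥d∥²≈0 : ∥ s ∥² * ∥ d ∥² ≈ 0#
    ∥s∥²∥d∥²≈0 = trans (lagrange s d)
      (sum-zero (trans (*-congʳ s⊥d) (zeroˡ _)) (trans (*-congʳ s∥d) (zeroˡ _)))
    ∥s∥²≈0 : ∥ s ∥² ≈ 0#
    ∥s∥²≈0 = cancel-nonzero (λ ∥d∥²≈0 → d≉0 (∥∥²-zero d ∥d∥²≈0)) ∥s∥²∥d∥²≈0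

  ≋-decidable : ∀ x y → x ≋ y ⊎ ¬ x ≋ y
  ≋-decidable (x₁ , x₂) (y₁ , y₂) with ≈-decidable x₁ y₁ | ≈-decidable x₂ y₂
  ... | inj₁ x₁≈y₁ | inj₁ x₂≈y₂ = inj₁ (x₁≈y₁ , x₂≈y₂)
  ... | inj₂ x₁≉y₁ | _ = inj₂ (λ x≋y → x₁≉y₁ (proj₁ x≋y))
  ... | _ | inj₂ x₂≉y₂ = inj₂ (λ x≋y → x₂≉y₂ (proj₂ x≋y))

  rhombus : ∀ a c x y → ¬ a ≋ c → ¬ x ≋ y →
            ∥ x ⊖ a ∥² ≈ 1# → ∥ x ⊖ c ∥² ≈ 1# → ∥ y ⊖ a ∥² ≈ 1# → ∥ y ⊖ c ∥² ≈ 1# →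
            x ⊕ y ≋ a ⊕ c
  rhombus a c x y a≉c x≉y xa xc ya yc =
    ≋-by-difference _ _ (≋.trans (translate x y) (≋-difference centred))
    where
    translate : ∀ x y → (x ⊕ y) ⊖ (a ⊕ c) ≋ ((x ⊖ a) ⊕ (y ⊖ a)) ⊖ (c ⊖ a)
    translate x y = V.solve 4 (λ a c x y →
      (x V.:+ y) V.:- (a V.:+ c) V.:= ((x V.:- a) V.:+ (y V.:- a)) V.:- (c V.:- a)) ≋.refl a c x y
    separate : ∀ x y → x ⊖ y ≋ (x ⊖ a) ⊖ (y ⊖ a)
    separate x y = V.solve 3 (λ a x y → x V.:- y V.:= (x V.:- a) V.:- (y V.:- a)) ≋.refl a x y
    recentre : ∀ z → (z ⊖ a) ⊖ (c ⊖ a) ≋ z ⊖ c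
    recentre z = V.solve 3 (λ a c z → (z V.:- a) V.:- (c V.:- a) V.:= z V.:- c) ≋.refl a c z
    centred : (x ⊖ a) ⊕ (y ⊖ a) ≋ c ⊖ a
    centred = two-circles (x ⊖ a) (y ⊖ a) (c ⊖ a)
      xa (trans (∥∥²-cong (recentre x)) xc) ya (trans (∥∥²-cong (recentre y)) yc)
      (λ xa≋ya → x≉y (≋-by-difference x y (≋.trans (separate x y) (≋-difference xa≋ya))))
      (λ ca≋0 → a≉c (≋.sym (≋-by-difference c a ca≋0)))

  rhombus-or-equal : ∀ a c x y → ¬ a ≋ c →
                     ∥ x ⊖ a ∥² ≈ 1# → ∥ x ⊖ c ∥² ≈ 1# → ∥ y ⊖ a ∥² ≈ 1# → ∥ y ⊖ c ∥² ≈ 1# →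
                     x ≋ y ⊎ x ⊕ y ≋ a ⊕ c
  rhombus-or-equal a c x y a≉c xa xc ya yc with ≋-decidable x y
  ... | inj₁ x≋y = inj₁ x≋y
  ... | inj₂ x≉y = inj₂ (rhombus a c x y a≉c x≉y xa xc ya yc)

module LinearForms (R : Reals) where
  open Plane R

  Form : ℕ → Set
  Form n = Vec ℤ n

  infixl 6 _+ᶠ_ _-ᶠ_
  _+ᶠ_ _-ᶠ_ : ∀ {n} → Form n → Form n → Form n
  f +ᶠ g = zipWith ℤ._+_ f g
  f -ᶠ g = zipWith ℤ._-_ f g

  0ᶠ : ∀ {n} → Form n
  0ᶠ = replicate _ (+ 0)

  basis : ∀ {n} → Fin n → Form n
  basis zero = + 1 ∷ 0ᶠ
  basis (suc i) = + 0 ∷ basis i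

  eval : ∀ {n} → (Fin n → Point R) → Form n → Point R
  eval φ [] = 𝟎
  eval φ (k ∷ f) = V.⟦ k ⟧ℤ ≋.* φ zero ⊕ eval (λ i → φ (suc i)) f

  eval-+ : ∀ {n} (φ : Fin n → Point R) f g → eval φ (f +ᶠ g) ≋ eval φ f ⊕ eval φ g
  eval-+ φ [] [] = ≋.sym (≋.+-identityʳ 𝟎)
  eval-+ φ (a ∷ f) (b ∷ g) = ≋.trans
    (≋.+-cong (≋.*-congʳ (V.+-homo a b)) (eval-+ (λ i → φ (suc i)) f g))
    (V.solve 5 (λ A B p F G → (A V.:+ B) V.:* p V.:+ (F V.:+ G)
                               V.:= (A V.:* p V.:+ F) V.:+ (B V.:* p V.:+ G))
       ≋.refl V.⟦ a ⟧ℤ V.⟦ b ⟧ℤ (φ zero) (eval (λ i → φ (suc i)) f) (eval (λ i → φ (suc i)) g))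

  eval-- : ∀ {n} (φ : Fin n → Point R) f g → eval φ (f -ᶠ g) ≋ eval φ f ⊖ eval φ g
  eval-- φ [] [] = ≋.sym (≋.-‿inverseʳ 𝟎)
  eval-- φ (a ∷ f) (b ∷ g) = ≋.trans
    (≋.+-cong (≋.*-congʳ (≋.trans (V.+-homo a (ℤ.- b)) (≋.+-congˡ (V.neg-homo b))))
              (eval-- (λ i → φ (suc i)) f g))
    (V.solve 5 (λ A B p F G → (A V.:- B) V.:* p V.:+ (F V.:- G)
                               V.:= (A V.:* p V.:+ F) V.:- (B V.:* p V.:+ G))
       ≋.refl V.⟦ a ⟧ℤ V.⟦ b ⟧ℤ (φ zero) (eval (λ i → φ (suc i)) f) (eval (λ i → φ (suc i)) g))

  eval-0 : ∀ {n} (φ : Fin n → Point R) → eval φ 0ᶠ ≋ 𝟎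
  eval-0 {zero} φ = ≋.refl
  eval-0 {suc n} φ = ≋.trans (≋.+-cong (≋.zeroˡ (φ zero)) (eval-0 (λ i → φ (suc i)))) (≋.+-identityʳ 𝟎)

  eval-basis : ∀ {n} (φ : Fin n → Point R) i → eval φ (basis i) ≋ φ i
  eval-basis φ zero = ≋.trans
    (≋.+-cong (≋.trans (≋.*-congʳ (≋.+-identityʳ ≋.1#)) (≋.*-identityˡ (φ zero))) (eval-0 (λ i → φ (suc i))))
    (≋.+-identityʳ (φ zero))
  eval-basis φ (suc i) = ≋.trans
    (≋.+-cong (≋.zeroˡ (φ zero)) (eval-basis (λ i → φ (suc i)) i))
    (≋.+-identityˡ (φ (suc i)))

adjacent? : ∀ {n} (E : EdgeList) (v w : Fin n) → Dec (Adj E v w)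
adjacent? E v w = (_ ∈? E) ⊎-dec (_ ∈? E)

module Drawing (R : Reals) {n : ℕ} (E : EdgeList) (drawing : UnitDistanceIn R n E) where
  open Reals R using (_≈_; 1#; trans)
  open Plane R
  open LinearForms R

  φ : Fin n → Point R
  φ = proj₁ drawing

  record Holds (f : Form n) : Set where
    constructor vanishing
    field vanishes : eval φ f ≋ 𝟎
  open Holds

  record Unit (f : Form n) : Set where
    constructor unit
    field length-1 : ∥ eval φ f ∥² ≈ 1#
  open Unit

  infixl 6 _+ʰ_ _-ʰ_
  infix 8 -ʰ_

  _+ʰ_ : ∀ {f g} → Holds f → Holds g → Holds (f +ᶠ g)
  _+ʰ_ {f} {g} f≋0 g≋0 = vanishing (≋.trans (eval-+ φ f g)
    (≋.trans (≋.+-cong (vanishes f≋0) (vanishes g≋0)) (≋.+-identityʳ 𝟎)))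

  _-ʰ_ : ∀ {f g} → Holds f → Holds g → Holds (f -ᶠ g)
  _-ʰ_ {f} {g} f≋0 g≋0 = vanishing (≋.trans (eval-- φ f g)
    (≋-difference (≋.trans (vanishes f≋0) (≋.sym (vanishes g≋0)))))

  trivial : Holds 0ᶠ
  trivial = vanishing (eval-0 φ)

  -ʰ_ : ∀ {f} → Holds f → Holds (0ᶠ -ᶠ f)
  -ʰ f≋0 = trivial -ʰ f≋0

  transfer : ∀ {f g} → Holds (f -ᶠ g) → Unit g → Unit f
  transfer {f} {g} f-g≋0 g-unit = unit (trans (∥∥²-cong f≋g) (length-1 g-unit))
    where
    f≋g : eval φ f ≋ eval φ g
    f≋g = ≋-by-difference _ _ (≋.trans (≋.sym (eval-- φ f g)) (vanishes f-g≋0))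

  -- the vertex with label k ∈ {1, …, n} (labels as in the edge list), and
  -- its form
  ⟨_⟩ : (k : ℕ) → {True (1 ℕ.≤? k ×-dec k ℕ.≤? n)} → Fin n
  ⟨ suc k ⟩ {valid} = fromℕ< (proj₂ (toWitness valid))

  v : (k : ℕ) → {True (1 ℕ.≤? k ×-dec k ℕ.≤? n)} → Form n
  v k {valid} = basis (⟨ k ⟩ {valid})

  eval-edge : ∀ i j → eval φ (basis i -ᶠ basis j) ≋ φ i ⊖ φ j
  eval-edge i j = ≋.trans (eval-- φ (basis i) (basis j))
                          (≋.+-cong (eval-basis φ i) (≋.-‿cong (eval-basis φ j)))

  edge : ∀ i j → {True (adjacent? E i j)} → Unit (basis i -ᶠ basis j)
  edge i j {adj} = unit (trans (∥∥²-cong (eval-edge i j)) (proj₂ (proj₂ drawing) i j (toWitness adj)))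

  separated : ∀ i j → {False (i Fin.≟ j)} → ¬ Holds (basis i -ᶠ basis j)
  separated i j {i≢j} i-j≋0 = toWitnessFalse i≢j (proj₁ (proj₂ drawing) i j
    (≋-by-difference _ _ (≋.trans (≋.sym (eval-edge i j)) (vanishes i-j≋0))))

  rhombus-or-equalᶠ : ∀ a c x y → ¬ Holds (a -ᶠ c) →
    Unit (x -ᶠ a) → Unit (x -ᶠ c) → Unit (y -ᶠ a) → Unit (y -ᶠ c) →
    Holds (x -ᶠ y) ⊎ Holds ((x +ᶠ y) -ᶠ (a +ᶠ c))
  rhombus-or-equalᶠ a c x y a≉c xa xc ya yc
    with rhombus-or-equal (eval φ a) (eval φ c) (eval φ x) (eval φ y)
           (λ a≋c → a≉c (vanishing (≋.trans (eval-- φ a c) (≋-difference a≋c))))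
           (length x a xa) (length x c xc) (length y a ya) (length y c yc)
    where
    length : ∀ p q → Unit (p -ᶠ q) → ∥ eval φ p ⊖ eval φ q ∥² ≈ 1#
    length p q pq = trans (∥∥²-cong (≋.sym (eval-- φ p q))) (length-1 pq)
  ... | inj₁ x≋y = inj₁ (vanishing (≋.trans (eval-- φ x y) (≋-difference x≋y)))
  ... | inj₂ x+y≋a+c = inj₂ (vanishing (≋.trans (eval-- φ (x +ᶠ y) (a +ᶠ c))
          (≋-difference (≋.trans (eval-+ φ x y) (≋.trans x+y≋a+c (≋.sym (eval-+ φ a c)))))))

  rhombusᶠ : ∀ a c x y → ¬ Holds (a -ᶠ c) → ¬ Holds (x -ᶠ y) →
    Unit (x -ᶠ a) → Unit (x -ᶠ c) → Unit (y -ᶠ a) → Unit (y -ᶠ c) →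
    Holds ((x +ᶠ y) -ᶠ (a +ᶠ c))
  rhombusᶠ a c x y a≉c x≉y xa xc ya yc with rhombus-or-equalᶠ a c x y a≉c xa xc ya yc
  ... | inj₁ x≋y = ⊥-elim (x≉y x≋y)
  ... | inj₂ x+y≋a+c = x+y≋a+c

  vertex-rhombus : ∀ a c x y → {False (a Fin.≟ c)} → {False (x Fin.≟ y)} →
    {True (adjacent? E x a)} → {True (adjacent? E x c)} →
    {True (adjacent? E y a)} → {True (adjacent? E y c)} →
    Holds ((basis x +ᶠ basis y) -ᶠ (basis a +ᶠ basis c))
  vertex-rhombus a c x y {a≢c} {x≢y} {xa} {xc} {ya} {yc} =
    rhombusᶠ (basis a) (basis c) (basis x) (basis y) (separated a c {a≢c}) (separated x y {x≢y})
      (edge x a {xa}) (edge x c {xc}) (edge y a {ya}) (edge y c {yc})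

module ForbiddenGraphs (R : Reals) where
  open LinearForms R

  -- Measured from p 3, the rhombi 5 6 3 1 and 6 7 3 5 put 7 at the
  -- reflection of 1 in 3, and so do the rhombi 2 4 3 1 and 4 8 3 2 for 8.
  F-8-13-3 : ¬ UnitDistanceIn R 8 ((1 , 5) ∷ (1 , 3) ∷ (1 , 2) ∷ (2 , 3) ∷ (3 , 5) ∷ (5 , 6) ∷ (6 , 7) ∷ (3 , 7) ∷ (3 , 6) ∷ (2 , 4) ∷ (3 , 4) ∷ (3 , 8) ∷ (4 , 8) ∷ [])
  F-8-13-3 drawing = separated ⟨ 7 ⟩ ⟨ 8 ⟩ (r₁ +ʰ r₂ -ʰ r₃ -ʰ r₄)
    where
    open Drawing R _ drawing
    r₁ : Holds ((v 6 +ᶠ v 1) -ᶠ (v 5 +ᶠ v 3))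
    r₁ = vertex-rhombus ⟨ 5 ⟩ ⟨ 3 ⟩ ⟨ 6 ⟩ ⟨ 1 ⟩
    r₂ : Holds ((v 7 +ᶠ v 5) -ᶠ (v 6 +ᶠ v 3))
    r₂ = vertex-rhombus ⟨ 6 ⟩ ⟨ 3 ⟩ ⟨ 7 ⟩ ⟨ 5 ⟩
    r₃ : Holds ((v 4 +ᶠ v 1) -ᶠ (v 2 +ᶠ v 3))
    r₃ = vertex-rhombus ⟨ 2 ⟩ ⟨ 3 ⟩ ⟨ 4 ⟩ ⟨ 1 ⟩
    r₄ : Holds ((v 8 +ᶠ v 2) -ᶠ (v 4 +ᶠ v 3))
    r₄ = vertex-rhombus ⟨ 4 ⟩ ⟨ 3 ⟩ ⟨ 8 ⟩ ⟨ 2 ⟩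

  -- From the rhombus 1 4 6 3, the point q = p 7 + p 1 - p 4 lies at distance
  -- 1 from p 1 and p 3, as does p 2.  With the rhombus 2 5 6 3, p 2 = q
  -- forces p 5 = p 7, and p 2 + q = p 1 + p 3 together with the rhombus
  -- 4 7 6 8 forces p 5 = p 8.
  F-8-12-1 : ¬ UnitDistanceIn R 8 ((4 , 6) ∷ (1 , 4) ∷ (1 , 2) ∷ (2 , 3) ∷ (3 , 6) ∷ (5 , 6) ∷ (2 , 5) ∷ (1 , 3) ∷ (4 , 7) ∷ (6 , 7) ∷ (6 , 8) ∷ (4 , 8) ∷ [])
  F-8-12-1 drawing = [ coincide , mirrored ]′
    (rhombus-or-equalᶠ (v 1) (v 3) (v 2) q (separated ⟨ 1 ⟩ ⟨ 3 ⟩) (edge ⟨ 2 ⟩ ⟨ 1 ⟩) (edge ⟨ 2 ⟩ ⟨ 3 ⟩)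
      (transfer trivial (edge ⟨ 7 ⟩ ⟨ 4 ⟩)) (transfer (-ʰ r₁) (edge ⟨ 7 ⟩ ⟨ 6 ⟩)))
    where
    open Drawing R _ drawing
    q : Form 8
    q = (v 7 +ᶠ v 1) -ᶠ v 4
    r₁ : Holds ((v 4 +ᶠ v 3) -ᶠ (v 1 +ᶠ v 6))
    r₁ = vertex-rhombus ⟨ 1 ⟩ ⟨ 6 ⟩ ⟨ 4 ⟩ ⟨ 3 ⟩
    r₂ : Holds ((v 5 +ᶠ v 3) -ᶠ (v 2 +ᶠ v 6))
    r₂ = vertex-rhombus ⟨ 2 ⟩ ⟨ 6 ⟩ ⟨ 5 ⟩ ⟨ 3 ⟩
    coincide : Holds (v 2 -ᶠ q) → ⊥
    coincide r₃ = separated ⟨ 5 ⟩ ⟨ 7 ⟩ (r₂ +ʰ r₃ -ʰ r₁)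
    mirrored : Holds ((v 2 +ᶠ q) -ᶠ (v 1 +ᶠ v 3)) → ⊥
    mirrored r₃ = separated ⟨ 5 ⟩ ⟨ 8 ⟩ (r₃ -ʰ r₄ +ʰ r₂)
      where
      r₄ : Holds ((v 7 +ᶠ v 8) -ᶠ (v 4 +ᶠ v 6))
      r₄ = vertex-rhombus ⟨ 4 ⟩ ⟨ 6 ⟩ ⟨ 7 ⟩ ⟨ 8 ⟩

  -- As for F(8,12,1) with q = p 8 + p 1 - p 4.  If p 2 = q then p 5 = p 8.
  -- Otherwise p 4 - p 5 = p 1 - p 2 has length 1, so 7 and 4 are common
  -- neighbours of 8 and 5; the resulting rhombus forces p 6 = p 7.
  F-8-12-2 : ¬ UnitDistanceIn R 8 ((4 , 6) ∷ (1 , 4) ∷ (1 , 2) ∷ (2 , 3) ∷ (3 , 6) ∷ (5 , 6) ∷ (2 , 5) ∷ (1 , 3) ∷ (6 , 8) ∷ (4 , 8) ∷ (7 , 8) ∷ (5 , 7) ∷ [])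
  F-8-12-2 drawing = [ coincide , mirrored ]′
    (rhombus-or-equalᶠ (v 1) (v 3) (v 2) q (separated ⟨ 1 ⟩ ⟨ 3 ⟩) (edge ⟨ 2 ⟩ ⟨ 1 ⟩) (edge ⟨ 2 ⟩ ⟨ 3 ⟩)
      (transfer trivial (edge ⟨ 8 ⟩ ⟨ 4 ⟩)) (transfer (-ʰ r₁) (edge ⟨ 8 ⟩ ⟨ 6 ⟩)))
    where
    open Drawing R _ drawing
    q : Form 8
    q = (v 8 +ᶠ v 1) -ᶠ v 4
    r₁ : Holds ((v 4 +ᶠ v 3) -ᶠ (v 1 +ᶠ v 6))
    r₁ = vertex-rhombus ⟨ 1 ⟩ ⟨ 6 ⟩ ⟨ 4 ⟩ ⟨ 3 ⟩
    r₂ : Holds ((v 5 +ᶠ v 3) -ᶠ (v 2 +ᶠ v 6))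
    r₂ = vertex-rhombus ⟨ 2 ⟩ ⟨ 6 ⟩ ⟨ 5 ⟩ ⟨ 3 ⟩
    coincide : Holds (v 2 -ᶠ q) → ⊥
    coincide r₃ = separated ⟨ 5 ⟩ ⟨ 8 ⟩ (r₂ +ʰ r₃ -ʰ r₁)
    mirrored : Holds ((v 2 +ᶠ q) -ᶠ (v 1 +ᶠ v 3)) → ⊥
    mirrored r₃ = separated ⟨ 6 ⟩ ⟨ 7 ⟩ (-ʰ r₃ -ʰ r₂ -ʰ r₄)
      where
      r₄ : Holds ((v 7 +ᶠ v 4) -ᶠ (v 8 +ᶠ v 5))
      r₄ = rhombusᶠ (v 8) (v 5) (v 7) (v 4) (separated ⟨ 8 ⟩ ⟨ 5 ⟩) (separated ⟨ 7 ⟩ ⟨ 4 ⟩)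
             (edge ⟨ 7 ⟩ ⟨ 8 ⟩) (edge ⟨ 7 ⟩ ⟨ 5 ⟩) (edge ⟨ 4 ⟩ ⟨ 8 ⟩) (transfer (r₁ -ʰ r₂) (edge ⟨ 1 ⟩ ⟨ 2 ⟩))

  -- Measured from p 3: 7 is the reflection of 1 (as in F(8,13,3)), the
  -- rhombus 2 4 3 1 gives p 4 - p 3 = p 2 - p 1, and the rhombus 2 8 7 3 then
  -- gives p 8 = p 4.
  F-8-13-4 : ¬ UnitDistanceIn R 8 ((1 , 5) ∷ (1 , 3) ∷ (1 , 2) ∷ (2 , 3) ∷ (3 , 5) ∷ (5 , 6) ∷ (6 , 7) ∷ (3 , 7) ∷ (3 , 6) ∷ (2 , 4) ∷ (3 , 4) ∷ (2 , 8) ∷ (7 , 8) ∷ [])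
  F-8-13-4 drawing = separated ⟨ 4 ⟩ ⟨ 8 ⟩ (r₃ -ʰ r₁ -ʰ r₂ -ʰ r₄)
    where
    open Drawing R _ drawing
    r₁ : Holds ((v 6 +ᶠ v 1) -ᶠ (v 5 +ᶠ v 3))
    r₁ = vertex-rhombus ⟨ 5 ⟩ ⟨ 3 ⟩ ⟨ 6 ⟩ ⟨ 1 ⟩
    r₂ : Holds ((v 7 +ᶠ v 5) -ᶠ (v 6 +ᶠ v 3))
    r₂ = vertex-rhombus ⟨ 6 ⟩ ⟨ 3 ⟩ ⟨ 7 ⟩ ⟨ 5 ⟩
    r₃ : Holds ((v 4 +ᶠ v 1) -ᶠ (v 2 +ᶠ v 3))
    r₃ = vertex-rhombus ⟨ 2 ⟩ ⟨ 3 ⟩ ⟨ 4 ⟩ ⟨ 1 ⟩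
    r₄ : Holds ((v 8 +ᶠ v 3) -ᶠ (v 2 +ᶠ v 7))
    r₄ = vertex-rhombus ⟨ 2 ⟩ ⟨ 7 ⟩ ⟨ 8 ⟩ ⟨ 3 ⟩

  -- As in F(8,13,4), now through the rhombus 2 4 7 3, p 4 - p 3 = p 2 - p 1
  -- has length 1.  Then 8 and 3 are common neighbours of 1 and 4, and the
  -- rhombus they form gives p 8 = p 2.
  F-8-13-5 : ¬ UnitDistanceIn R 8 ((1 , 8) ∷ (4 , 8) ∷ (1 , 5) ∷ (1 , 3) ∷ (1 , 2) ∷ (2 , 3) ∷ (3 , 5) ∷ (5 , 6) ∷ (6 , 7) ∷ (3 , 7) ∷ (3 , 6) ∷ (4 , 7) ∷ (2 , 4) ∷ [])
  F-8-13-5 drawing = separated ⟨ 2 ⟩ ⟨ 8 ⟩ (-ʰ r₁ -ʰ r₂ -ʰ r₃ -ʰ r₄)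
    where
    open Drawing R _ drawing
    r₁ : Holds ((v 6 +ᶠ v 1) -ᶠ (v 5 +ᶠ v 3))
    r₁ = vertex-rhombus ⟨ 5 ⟩ ⟨ 3 ⟩ ⟨ 6 ⟩ ⟨ 1 ⟩
    r₂ : Holds ((v 7 +ᶠ v 5) -ᶠ (v 6 +ᶠ v 3))
    r₂ = vertex-rhombus ⟨ 6 ⟩ ⟨ 3 ⟩ ⟨ 7 ⟩ ⟨ 5 ⟩
    r₃ : Holds ((v 4 +ᶠ v 3) -ᶠ (v 2 +ᶠ v 7))
    r₃ = vertex-rhombus ⟨ 2 ⟩ ⟨ 7 ⟩ ⟨ 4 ⟩ ⟨ 3 ⟩
    r₄ : Holds ((v 8 +ᶠ v 3) -ᶠ (v 1 +ᶠ v 4))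
    r₄ = rhombusᶠ (v 1) (v 4) (v 8) (v 3) (separated ⟨ 1 ⟩ ⟨ 4 ⟩) (separated ⟨ 8 ⟩ ⟨ 3 ⟩)
           (edge ⟨ 8 ⟩ ⟨ 1 ⟩) (edge ⟨ 8 ⟩ ⟨ 4 ⟩) (edge ⟨ 3 ⟩ ⟨ 1 ⟩) (transfer (-ʰ r₁ -ʰ r₂ -ʰ r₃) (edge ⟨ 1 ⟩ ⟨ 2 ⟩))

  -- As in F(8,13,5), but 8 and 3 are common neighbours of 5 and 4; with the
  -- rhombus 1 5 3 2 this gives p 8 = p 3.
  F-8-13-6 : ¬ UnitDistanceIn R 8 ((5 , 8) ∷ (4 , 8) ∷ (1 , 5) ∷ (1 , 3) ∷ (1 , 2) ∷ (2 , 3) ∷ (3 , 5) ∷ (5 , 6) ∷ (6 , 7) ∷ (3 , 7) ∷ (3 , 6) ∷ (4 , 7) ∷ (2 , 4) ∷ [])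
  F-8-13-6 drawing = separated ⟨ 3 ⟩ ⟨ 8 ⟩ (-ʰ r₀ -ʰ r₁ -ʰ r₂ -ʰ r₃ -ʰ r₄)
    where
    open Drawing R _ drawing
    r₀ : Holds ((v 5 +ᶠ v 2) -ᶠ (v 1 +ᶠ v 3))
    r₀ = vertex-rhombus ⟨ 1 ⟩ ⟨ 3 ⟩ ⟨ 5 ⟩ ⟨ 2 ⟩
    r₁ : Holds ((v 6 +ᶠ v 1) -ᶠ (v 5 +ᶠ v 3))
    r₁ = vertex-rhombus ⟨ 5 ⟩ ⟨ 3 ⟩ ⟨ 6 ⟩ ⟨ 1 ⟩
    r₂ : Holds ((v 7 +ᶠ v 5) -ᶠ (v 6 +ᶠ v 3))
    r₂ = vertex-rhombus ⟨ 6 ⟩ ⟨ 3 ⟩ ⟨ 7 ⟩ ⟨ 5 ⟩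
    r₃ : Holds ((v 4 +ᶠ v 3) -ᶠ (v 2 +ᶠ v 7))
    r₃ = vertex-rhombus ⟨ 2 ⟩ ⟨ 7 ⟩ ⟨ 4 ⟩ ⟨ 3 ⟩
    r₄ : Holds ((v 8 +ᶠ v 3) -ᶠ (v 5 +ᶠ v 4))
    r₄ = rhombusᶠ (v 5) (v 4) (v 8) (v 3) (separated ⟨ 5 ⟩ ⟨ 4 ⟩) (separated ⟨ 8 ⟩ ⟨ 3 ⟩)
           (edge ⟨ 8 ⟩ ⟨ 5 ⟩) (edge ⟨ 8 ⟩ ⟨ 4 ⟩) (edge ⟨ 3 ⟩ ⟨ 5 ⟩) (transfer (-ʰ r₁ -ʰ r₂ -ʰ r₃) (edge ⟨ 1 ⟩ ⟨ 2 ⟩))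

  -- The rhombi 2 1 3 4, 6 5 7 8 and 4 3 7 8 show that p 5 and
  -- u = p 1 + p 3 - p 2 are both at distance 1 from p 1 and from
  -- w = 2 p 1 - p 2.  If p 5 = u then p 3 = p 6; if p 5 + u = p 1 + w then
  -- the rhombus 3 1 5 7 gives p 1 = p 7.
  F-8-13-7 : ¬ UnitDistanceIn R 8 ((1 , 3) ∷ (1 , 2) ∷ (2 , 4) ∷ (3 , 4) ∷ (2 , 3) ∷ (5 , 7) ∷ (5 , 6) ∷ (6 , 8) ∷ (7 , 8) ∷ (1 , 5) ∷ (3 , 7) ∷ (4 , 8) ∷ (1 , 6) ∷ [])
  F-8-13-7 drawing = [ coincide , mirrored ]′
    (rhombus-or-equalᶠ (v 1) w (v 5) u (separated ⟨ 2 ⟩ ⟨ 1 ⟩) (edge ⟨ 5 ⟩ ⟨ 1 ⟩)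
      (transfer (r₂ -ʰ r₁ -ʰ r₄) (edge ⟨ 6 ⟩ ⟨ 1 ⟩))
      (transfer trivial (edge ⟨ 3 ⟩ ⟨ 2 ⟩)) (transfer trivial (edge ⟨ 3 ⟩ ⟨ 1 ⟩)))
    where
    open Drawing R _ drawing
    w u : Form 8
    w = (v 1 +ᶠ v 1) -ᶠ v 2
    u = (v 1 +ᶠ v 3) -ᶠ v 2
    r₁ : Holds ((v 1 +ᶠ v 4) -ᶠ (v 2 +ᶠ v 3))
    r₁ = vertex-rhombus ⟨ 2 ⟩ ⟨ 3 ⟩ ⟨ 1 ⟩ ⟨ 4 ⟩
    r₂ : Holds ((v 5 +ᶠ v 8) -ᶠ (v 6 +ᶠ v 7))
    r₂ = vertex-rhombus ⟨ 6 ⟩ ⟨ 7 ⟩ ⟨ 5 ⟩ ⟨ 8 ⟩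
    r₃ : Holds ((v 1 +ᶠ v 7) -ᶠ (v 3 +ᶠ v 5))
    r₃ = vertex-rhombus ⟨ 3 ⟩ ⟨ 5 ⟩ ⟨ 1 ⟩ ⟨ 7 ⟩
    r₄ : Holds ((v 3 +ᶠ v 8) -ᶠ (v 4 +ᶠ v 7))
    r₄ = vertex-rhombus ⟨ 4 ⟩ ⟨ 7 ⟩ ⟨ 3 ⟩ ⟨ 8 ⟩
    coincide : Holds (v 5 -ᶠ u) → ⊥
    coincide r₅ = separated ⟨ 3 ⟩ ⟨ 6 ⟩ (r₂ -ʰ r₁ -ʰ r₄ -ʰ r₅)
    mirrored : Holds ((v 5 +ᶠ u) -ᶠ (v 1 +ᶠ w)) → ⊥
    mirrored r₅ = separated ⟨ 1 ⟩ ⟨ 7 ⟩ (-ʰ r₃ -ʰ r₅)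

mainTheorem3 :
    Forbidden 8 ((4 , 6) ∷ (1 , 4) ∷ (1 , 2) ∷ (2 , 3) ∷ (3 , 6) ∷ (5 , 6) ∷ (2 , 5) ∷ (1 , 3) ∷ (4 , 7) ∷ (6 , 7) ∷ (6 , 8) ∷ (4 , 8) ∷ [])
    × Forbidden 8 ((4 , 6) ∷ (1 , 4) ∷ (1 , 2) ∷ (2 , 3) ∷ (3 , 6) ∷ (5 , 6) ∷ (2 , 5) ∷ (1 , 3) ∷ (6 , 8) ∷ (4 , 8) ∷ (7 , 8) ∷ (5 , 7) ∷ [])
    × Forbidden 8 ((1 , 5) ∷ (1 , 3) ∷ (1 , 2) ∷ (2 , 3) ∷ (3 , 5) ∷ (5 , 6) ∷ (6 , 7) ∷ (3 , 7) ∷ (3 , 6) ∷ (2 , 4) ∷ (3 , 4) ∷ (3 , 8) ∷ (4 , 8) ∷ [])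
    × Forbidden 8 ((1 , 5) ∷ (1 , 3) ∷ (1 , 2) ∷ (2 , 3) ∷ (3 , 5) ∷ (5 , 6) ∷ (6 , 7) ∷ (3 , 7) ∷ (3 , 6) ∷ (2 , 4) ∷ (3 , 4) ∷ (2 , 8) ∷ (7 , 8) ∷ [])
    × Forbidden 8 ((1 , 8) ∷ (4 , 8) ∷ (1 , 5) ∷ (1 , 3) ∷ (1 , 2) ∷ (2 , 3) ∷ (3 , 5) ∷ (5 , 6) ∷ (6 , 7) ∷ (3 , 7) ∷ (3 , 6) ∷ (4 , 7) ∷ (2 , 4) ∷ [])
    × Forbidden 8 ((5 , 8) ∷ (4 , 8) ∷ (1 , 5) ∷ (1 , 3) ∷ (1 , 2) ∷ (2 , 3) ∷ (3 , 5) ∷ (5 , 6) ∷ (6 , 7) ∷ (3 , 7) ∷ (3 , 6) ∷ (4 , 7) ∷ (2 , 4) ∷ [])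
    × Forbidden 8 ((1 , 3) ∷ (1 , 2) ∷ (2 , 4) ∷ (3 , 4) ∷ (2 , 3) ∷ (5 , 7) ∷ (5 , 6) ∷ (6 , 8) ∷ (7 , 8) ∷ (1 , 5) ∷ (3 , 7) ∷ (4 , 8) ∷ (1 , 6) ∷ [])
mainTheorem3 =
    F-8-12-1 , F-8-12-2 , F-8-13-3 , F-8-13-4 , F-8-13-5 , F-8-13-6 , F-8-13-7
  where open ForbiddenGraphs
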